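{- Let $(a_1,a_2,\dots)$ and $(b_1,b_2,\dots)$ be sequences of integers with only finitely many nonzero terms. Then \[ \sum_{1\le i\le j}(a_i-b_i)(b_j-a_{j+1})=\sum_{i\ge1}\left(\binom{a_i}{2}-\binom{b_i}{2}\right)-\binom{\sum_{i\ge1}(a_i-b_i)}{2}. \]
   Context: For any integer $c$, $\binom{c}{2}$ denotes $c(c-1)/2$. -}

module Defs where

open import Data.Nat using (ℕ; zero; suc; _<_)
open import Relation.Binary.PropositionalEquality using (_≡_)
open import Data.Integer using (ℤ; +_; _+_; _-_; _*_)
open import Data.Integer.DivMod using (_/_)

-- binomial c choose 2 := c(c-1)/2 for an integer c (division is exact, c(c-1) is even)
choose2 : ℤ → ℤ
choose2 c = (c * (c - + 1)) / (+ 2)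

sumTo : ℕ → (ℕ → ℤ) → ℤ
sumTo zero    f = + 0
sumTo (suc n) f = sumTo n f + f (suc n)

-- a sequence (indexed from 1; the value at index 0 is ignored) vanishing beyond N
VanishesBeyond : ℕ → (ℕ → ℤ) → Set
VanishesBeyond N a = ∀ i → N < i → a i ≡ + 0

{-# OPTIONS --safe #-}
module Submission where

-- With d i = a i - b i and D n = d 1 + ... + d n, induction on n shows that for every n the
-- truncated double sum equals  Σ (C(a i, 2) - C(b i, 2)) - C(D n, 2) - D n * a (n + 1);
-- the inductive step only uses the addition law C(x + y, 2) = C(x, 2) + C(y, 2) + x y.
-- Once a vanishes beyond N the boundary term D N * a (N + 1) is zero.

open import Defs
import Data.Nat as ℕ
open import Data.Nat using (ℕ; zero; suc)
open import Data.Nat.Properties using (n<1+n)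
open import Data.Nat.Combinatorics using (_C_; nC1≡n; nCk+nC[k+1]≡[n+1]C[k+1])
open import Data.Nat.DivMod using (m*n/n≡m)
open import Data.Integer using (ℤ; +_; -[1+_]; _+_; _-_; -_; _*_; _/_)
open import Data.Integer.Properties using (*-cancelʳ-≡; *-distribʳ-+; *-zeroʳ; +-identityʳ; pos-*)
open import Data.Integer.DivMod using (div-pos-is-/ℕ)
open import Data.Integer.Tactic.RingSolver using (solve-∀)
open import Data.Product using (∃-syntax; _,_)
open import Relation.Binary.PropositionalEquality using (_≡_; refl; sym; trans; cong; cong₂; module ≡-Reasoning)
open ≡-Reasoning

nC2*2≡n*[n-1] : ∀ n → + (n C 2) * + 2 ≡ + n * (+ n - + 1)
nC2*2≡n*[n-1] zero    = refl
nC2*2≡n*[n-1] (suc n) = begin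
  + (suc n C 2) * + 2              ≡⟨ cong (λ m → + m * + 2) (sym (nCk+nC[k+1]≡[n+1]C[k+1] n 1)) ⟩
  + (n C 1 ℕ.+ n C 2) * + 2        ≡⟨ cong (λ m → + (m ℕ.+ n C 2) * + 2) (nC1≡n n) ⟩
  (+ n + + (n C 2)) * + 2          ≡⟨ *-distribʳ-+ (+ 2) (+ n) (+ (n C 2)) ⟩
  + n * + 2 + + (n C 2) * + 2      ≡⟨ cong (_+_ (+ n * + 2)) (nC2*2≡n*[n-1] n) ⟩
  + n * + 2 + + n * (+ n - + 1)    ≡⟨ square-step (+ n) ⟩
  + suc n * (+ suc n - + 1)        ∎
  where
  square-step : ∀ x → x * + 2 + x * (x - + 1) ≡ (+ 1 + x) * ((+ 1 + x) - + 1)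
  square-step = solve-∀

consecutive-product-even : ∀ c → ∃[ m ] c * (c - + 1) ≡ + m * + 2
consecutive-product-even (+ n)    = n C 2 , sym (nC2*2≡n*[n-1] n)
consecutive-product-even -[1+ n ] = suc (suc n) C 2 , (begin
  -[1+ n ] * (-[1+ n ] - + 1)            ≡⟨ negation-shift (+ n) ⟩
  + suc (suc n) * (+ suc (suc n) - + 1)  ≡⟨ sym (nC2*2≡n*[n-1] (suc (suc n))) ⟩
  + (suc (suc n) C 2) * + 2              ∎)
  where
  negation-shift : ∀ x → - (+ 1 + x) * (- (+ 1 + x) - + 1) ≡ (+ 2 + x) * ((+ 2 + x) - + 1)
  negation-shift = solve-∀

choose2*2≡c*[c-1] : ∀ c → choose2 c * + 2 ≡ c * (c - + 1)
choose2*2≡c*[c-1] c with consecutive-product-even c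
... | m , even = begin
  (c * (c - + 1)) / + 2 * + 2   ≡⟨ cong (λ t → t / + 2 * + 2) even ⟩
  (+ m * + 2) / + 2 * + 2       ≡⟨ cong (_* + 2) [m*2]/2≡m ⟩
  + m * + 2                     ≡⟨ sym even ⟩
  c * (c - + 1)                 ∎
  where
  [m*2]/2≡m : (+ m * + 2) / + 2 ≡ + m
  [m*2]/2≡m = begin
    (+ m * + 2) / + 2  ≡⟨ cong (_/ + 2) (sym (pos-* m 2)) ⟩
    + (m ℕ.* 2) / + 2  ≡⟨ div-pos-is-/ℕ (+ (m ℕ.* 2)) 2 ⟩
    + (m ℕ.* 2 ℕ./ 2)  ≡⟨ cong +_ (m*n/n≡m m 2) ⟩
    + m                ∎

choose2-+ : ∀ x y → choose2 (x + y) ≡ choose2 x + choose2 y + x * y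
choose2-+ x y = *-cancelʳ-≡ _ _ (+ 2) (begin
  choose2 (x + y) * + 2                              ≡⟨ choose2*2≡c*[c-1] (x + y) ⟩
  (x + y) * (x + y - + 1)                            ≡⟨ expand x y ⟩
  x * (x - + 1) + y * (y - + 1) + x * y * + 2        ≡⟨ cong₂ (λ s t → s + t + x * y * + 2)
                                                          (sym (choose2*2≡c*[c-1] x)) (sym (choose2*2≡c*[c-1] y)) ⟩
  choose2 x * + 2 + choose2 y * + 2 + x * y * + 2    ≡⟨ collect (choose2 x) (choose2 y) (x * y) ⟩
  (choose2 x + choose2 y + x * y) * + 2              ∎)
  where
  expand : ∀ x y → (x + y) * (x + y - + 1) ≡ x * (x - + 1) + y * (y - + 1) + x * y * + 2
  expand = solve-∀
  collect : ∀ s t u → s * + 2 + t * + 2 + u * + 2 ≡ (s + t + u) * + 2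
  collect = solve-∀

choose2-minus : ∀ p q → choose2 p - choose2 q ≡ choose2 (p - q) + (p - q) * q
choose2-minus p q = begin
  choose2 p - choose2 q                                 ≡⟨ cong (λ t → choose2 t - choose2 q) (sym (subtract-add p q)) ⟩
  choose2 (p - q + q) - choose2 q                       ≡⟨ cong (_- choose2 q) (choose2-+ (p - q) q) ⟩
  choose2 (p - q) + choose2 q + (p - q) * q - choose2 q ≡⟨ cancel (choose2 (p - q)) (choose2 q) ((p - q) * q) ⟩
  choose2 (p - q) + (p - q) * q                         ∎
  where
  subtract-add : ∀ p q → p - q + q ≡ p
  subtract-add = solve-∀
  cancel : ∀ s t u → s + t + u - t ≡ s + u
  cancel = solve-∀

closed-form-step : ∀ S D p q r →
  S - choose2 D - D * p + (D + (p - q)) * (q - r)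
  ≡ S + (choose2 p - choose2 q) - choose2 (D + (p - q)) - (D + (p - q)) * r
closed-form-step S D p q r = begin
  S - choose2 D - D * p + (D + (p - q)) * (q - r)
    ≡⟨ rearrange S D p q r (choose2 D) (choose2 (p - q)) ⟩
  S + (choose2 (p - q) + (p - q) * q) - (choose2 D + choose2 (p - q) + D * (p - q)) - (D + (p - q)) * r
    ≡⟨ cong₂ (λ s t → S + s - t - (D + (p - q)) * r) (choose2-minus p q) (choose2-+ D (p - q)) ⟨
  S + (choose2 p - choose2 q) - choose2 (D + (p - q)) - (D + (p - q)) * r
    ∎
  where
  rearrange : ∀ S D p q r cD cd →
    S - cD - D * p + (D + (p - q)) * (q - r)
    ≡ S + (cd + (p - q) * q) - (cD + cd + D * (p - q)) - (D + (p - q)) * r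
  rearrange = solve-∀

sumTo-*ʳ : ∀ n f c → sumTo n (λ i → f i * c) ≡ sumTo n f * c
sumTo-*ʳ zero    f c = refl
sumTo-*ʳ (suc n) f c = begin
  sumTo n (λ i → f i * c) + f (suc n) * c  ≡⟨ cong (_+ f (suc n) * c) (sumTo-*ʳ n f c) ⟩
  sumTo n f * c + f (suc n) * c            ≡⟨ *-distribʳ-+ c (sumTo n f) (f (suc n)) ⟨
  (sumTo n f + f (suc n)) * c              ∎

double-sum-closed-form : (a b : ℕ → ℤ) (n : ℕ) →
  sumTo n (λ j → sumTo j (λ i → (a i - b i) * (b j - a (suc j))))
  ≡ sumTo n (λ i → choose2 (a i) - choose2 (b i)) - choose2 (sumTo n (λ i → a i - b i))
    - sumTo n (λ i → a i - b i) * a (suc n)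
double-sum-closed-form a b zero    = refl
double-sum-closed-form a b (suc n) = trans
  (cong₂ _+_ (double-sum-closed-form a b n) (sumTo-*ʳ (suc n) (λ i → a i - b i) (b (suc n) - a (suc (suc n)))))
  (closed-form-step (sumTo n (λ i → choose2 (a i) - choose2 (b i))) (sumTo n (λ i → a i - b i))
                    (a (suc n)) (b (suc n)) (a (suc (suc n))))

lemma4p9 : (a b : ℕ → ℤ) (N : ℕ) → VanishesBeyond N a → VanishesBeyond N b →
    sumTo N (λ j → sumTo j (λ i → (a i - b i) * (b j - a (suc j))))
      ≡ sumTo N (λ i → choose2 (a i) - choose2 (b i)) - choose2 (sumTo N (λ i → a i - b i))
lemma4p9 a b N a-vanishes _ = begin
  sumTo N (λ j → sumTo j (λ i → (a i - b i) * (b j - a (suc j))))  ≡⟨ double-sum-closed-form a b N ⟩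
  X - D * a (suc N)                                                ≡⟨ cong (λ t → X - D * t) (a-vanishes (suc N) (n<1+n N)) ⟩
  X - D * + 0                                                      ≡⟨ cong (_-_ X) (*-zeroʳ D) ⟩
  X + + 0                                                          ≡⟨ +-identityʳ X ⟩
  X                                                                ∎
  where
  D : ℤ
  D = sumTo N (λ i → a i - b i)
  X : ℤ
  X = sumTo N (λ i → choose2 (a i) - choose2 (b i)) - choose2 D
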